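{- Let $n,k,m$ be positive integers with $k\le n$, and let $\mathbf r=(r_0,r_1,\ldots)$ be given by $r_i=\binom{i+m-1}{i}$ for $i=0,1,2,\ldots$. Then \[C^{(\mathbf r)}(n,k)=\binom{n-k+mk-1}{n-k}.\]
   Context: For a sequence $\mathbf r=(r_0,r_1,\ldots)$ and nonnegative integers $k\le n$, $C^{(\mathbf r)}(n,k)$ is defined by $C^{(\mathbf r)}(0,0)=1$, $C^{(\mathbf r)}(n,0)=0$ for $n>0$, $C^{(\mathbf r)}(n,1)=r_{n-1}$ for $n\ge1$, and $C^{(\mathbf r)}(n,k)=\sum_{i=0}^{n-k}r_iC^{(\mathbf r)}(n-i-1,k-1)$ for $1<k\le n$ (with $C^{(\mathbf r)}(n,k)=0$ for $0<n<k$). -}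

module Defs where

open import Data.Nat using (ℕ; zero; suc; _+_; _*_; _∸_; _≤_; _<_)

-- Recursive definition of C^(r)(n,k) exactly as in the paper:
--   C(0,0) = 1, C(n,0) = 0 for n > 0, C(n,k) = 0 for 0 < n < k,
--   C(n,1) = r_{n-1},
--   C(n,k) = Σ_{i=0}^{n-k} r_i C(n-i-1, k-1) for 1 < k ≤ n.
-- The general clause below sums over i = 0..n-1 (with n := suc n'), i.e.
-- C(n'+1, k'+1) = Σ_{i=0}^{n'} r_i C(n'-i, k'); the extra terms with
-- i > n-k vanish since then n'-i < k', and for k'=0 this gives r_{n'}.
-- Termination: the inner calls are on first argument n' - i < n'+1, so we
-- use an auxiliary sum indexed by the remaining length.

mutual
  Cr : (ℕ → ℕ) → ℕ → ℕ → ℕ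
  Cr r zero    zero    = 1
  Cr r zero    (suc k) = 0
  Cr r (suc n) zero    = 0
  Cr r (suc n) (suc k) = Csum r n k zero

  Csum : (ℕ → ℕ) → ℕ → ℕ → ℕ → ℕ
  Csum r zero    k i = r i * Cr r zero k
  Csum r (suc j) k i = r i * Cr r (suc j) k + Csum r j k (suc i)

module Submission where

-- The weights r_i = ((i + m - 1) choose i) are the coefficients of R(x) = (1 - x)^(-m), and the
-- recursion makes C(k + d, k) the coefficient of x^d in R(x)^k = (1 - x)^(-mk), that is
-- ((d + mk - 1) choose d).  Concretely: the diagonal column C(k + d, k), as a function of d,
-- is the convolution of r with the column C(· , k - 1) shifted by k - 1 (the entries above
-- the diagonal vanish), and multiset coefficients satisfy the Vandermonde identity
-- Σ_t H(a, t) H(b, d - t) = H(a + b, d), where r_i = H(m, i).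

open import Defs
open import Data.Nat using (ℕ; zero; suc; _+_; _*_; _∸_; _≤_; _<_; s≤s; z≤n)
open import Data.Nat.Properties
open import Data.Nat.Combinatorics using (_C_; k>n⇒nCk≡0; nCk+nC[k+1]≡[n+1]C[k+1])
open import Relation.Binary.PropositionalEquality using (_≡_; refl; sym; trans; cong; cong₂; module ≡-Reasoning)
open import Data.Nat.Solver using (module +-*-Solver)
open +-*-Solver using (solve; _:+_; _:*_; _:=_)
open ≡-Reasoning

multichoose : ℕ → ℕ → ℕ
multichoose a       zero    = 1
multichoose zero    (suc i) = 0
multichoose (suc a) (suc i) = multichoose a (suc i) + multichoose (suc a) i

C≡multichoose : ∀ a i → (i + a ∸ 1) C i ≡ multichoose a i
C≡multichoose a       zero    = refl
C≡multichoose zero    (suc i) = trans (cong (_C suc i) (+-identityʳ i)) (k>n⇒nCk≡0 (n<1+n i))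
C≡multichoose (suc a) (suc i) = begin
  (suc i + suc a ∸ 1) C suc i              ≡⟨ cong (_C suc i) (+-suc i a) ⟩
  suc (i + a) C suc i                      ≡⟨ sym (nCk+nC[k+1]≡[n+1]C[k+1] (i + a) i) ⟩
  (i + a) C i + (i + a) C suc i            ≡⟨ +-comm ((i + a) C i) _ ⟩
  (i + a) C suc i + (i + a) C i            ≡⟨ cong₂ _+_ (C≡multichoose a (suc i)) second-summand ⟩
  multichoose a (suc i) + multichoose (suc a) i ∎
  where
  second-summand : (i + a) C i ≡ multichoose (suc a) i
  second-summand = trans (cong (λ x → (x ∸ 1) C i) (sym (+-suc i a))) (C≡multichoose (suc a) i)

mutual
  Cr-above-diagonal : ∀ r {n k} → n < k → Cr r n k ≡ 0
  Cr-above-diagonal r {zero}  {suc k} _         = refl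
  Cr-above-diagonal r {suc n} {suc k} (s≤s n<k) = Csum-above-diagonal r 0 n<k

  Csum-above-diagonal : ∀ r {j k} i → j < k → Csum r j k i ≡ 0
  Csum-above-diagonal r {zero}  i j<k =
    trans (cong (r i *_) (Cr-above-diagonal r j<k)) (*-zeroʳ (r i))
  Csum-above-diagonal r {suc j} i j<k = cong₂ _+_
    (trans (cong (r i *_) (Cr-above-diagonal r j<k)) (*-zeroʳ (r i)))
    (Csum-above-diagonal r (suc i) (<-trans (n<1+n j) j<k))

convolveFrom : (ℕ → ℕ) → (ℕ → ℕ) → ℕ → ℕ → ℕ
convolveFrom f g zero    i = f i * g zero
convolveFrom f g (suc j) i = f i * g (suc j) + convolveFrom f g j (suc i)

Csum≡convolveFrom : ∀ r j k i → Csum r j k i ≡ convolveFrom r (λ s → Cr r s k) j i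
Csum≡convolveFrom r zero    k i = refl
Csum≡convolveFrom r (suc j) k i = cong (r i * Cr r (suc j) k +_) (Csum≡convolveFrom r j k (suc i))

convolveFrom-cong : ∀ {f f′ g g′} → (∀ x → f x ≡ f′ x) → (∀ x → g x ≡ g′ x) →
                    ∀ j i → convolveFrom f g j i ≡ convolveFrom f′ g′ j i
convolveFrom-cong f≗f′ g≗g′ zero    i = cong₂ _*_ (f≗f′ i) (g≗g′ zero)
convolveFrom-cong f≗f′ g≗g′ (suc j) i =
  cong₂ _+_ (cong₂ _*_ (f≗f′ i) (g≗g′ (suc j))) (convolveFrom-cong f≗f′ g≗g′ j (suc i))

convolveFrom-vanishing : ∀ f g j → (∀ s → s ≤ j → g s ≡ 0) → ∀ i → convolveFrom f g j i ≡ 0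
convolveFrom-vanishing f g zero    g≡0 i = trans (cong (f i *_) (g≡0 zero z≤n)) (*-zeroʳ (f i))
convolveFrom-vanishing f g (suc j) g≡0 i = cong₂ _+_
  (trans (cong (f i *_) (g≡0 (suc j) ≤-refl)) (*-zeroʳ (f i)))
  (convolveFrom-vanishing f g j (λ s s≤j → g≡0 s (m≤n⇒m≤1+n s≤j)) (suc i))

convolveFrom-shift : ∀ f g k → (∀ s → s < k → g s ≡ 0) →
                     ∀ d i → convolveFrom f g (k + d) i ≡ convolveFrom f (λ e → g (k + e)) d i
convolveFrom-shift f g zero    g≡0 zero i = refl
convolveFrom-shift f g (suc k) g≡0 zero i = begin
  f i * g (suc (k + 0)) + convolveFrom f g (k + 0) (suc i) ≡⟨ cong (f i * g (suc (k + 0)) +_) tail≡0 ⟩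
  f i * g (suc (k + 0)) + 0                                ≡⟨ +-identityʳ _ ⟩
  f i * g (suc (k + 0))                                    ∎
  where
  tail≡0 : convolveFrom f g (k + 0) (suc i) ≡ 0
  tail≡0 = convolveFrom-vanishing f g (k + 0)
    (λ s s≤k+0 → g≡0 s (s≤s (≤-trans s≤k+0 (≤-reflexive (+-identityʳ k))))) (suc i)
convolveFrom-shift f g k g≡0 (suc d) i = begin
  convolveFrom f g (k + suc d) i                         ≡⟨ cong (λ j → convolveFrom f g j i) (+-suc k d) ⟩
  f i * g (suc (k + d)) + convolveFrom f g (k + d) (suc i) ≡⟨ cong₂ _+_ (cong (λ x → f i * g x) (sym (+-suc k d)))
                                                                        (convolveFrom-shift f g k g≡0 d (suc i)) ⟩
  convolveFrom f (λ e → g (k + e)) (suc d) i             ∎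

convolveFrom-multichoose-zero : ∀ g d i → convolveFrom (multichoose 0) g d (suc i) ≡ 0
convolveFrom-multichoose-zero g zero    i = refl
convolveFrom-multichoose-zero g (suc d) i = convolveFrom-multichoose-zero g d (suc i)

convolveFrom-multichoose-suc : ∀ a g d i →
  convolveFrom (multichoose (suc a)) g d (suc i) ≡
  convolveFrom (multichoose a) g d (suc i) + convolveFrom (multichoose (suc a)) g d i
convolveFrom-multichoose-suc a g zero    i = *-distribʳ-+ (g zero) (multichoose a (suc i)) (multichoose (suc a) i)
convolveFrom-multichoose-suc a g (suc d) i = begin
  (x + y) * z + convolveFrom (multichoose (suc a)) g d (suc (suc i))
    ≡⟨ cong ((x + y) * z +_) (convolveFrom-multichoose-suc a g d (suc i)) ⟩
  (x + y) * z + (u + v)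
    ≡⟨ solve 5 (λ x y z u v → (x :+ y) :* z :+ (u :+ v) := (x :* z :+ u) :+ (y :* z :+ v)) refl x y z u v ⟩
  (x * z + u) + (y * z + v) ∎
  where
  x y z u v : ℕ
  x = multichoose a (suc i)
  y = multichoose (suc a) i
  z = g (suc d)
  u = convolveFrom (multichoose a) g d (suc (suc i))
  v = convolveFrom (multichoose (suc a)) g d (suc i)

multichoose-vandermonde : ∀ a b d →
  convolveFrom (multichoose a) (multichoose b) d 0 ≡ multichoose (a + b) d
multichoose-vandermonde zero    b zero    = +-identityʳ (multichoose b zero)
multichoose-vandermonde zero    b (suc d) = begin
  multichoose b (suc d) + 0 + convolveFrom (multichoose 0) (multichoose b) d 1
    ≡⟨ cong (multichoose b (suc d) + 0 +_) (convolveFrom-multichoose-zero (multichoose b) d 0) ⟩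
  multichoose b (suc d) + 0 + 0
    ≡⟨ trans (+-identityʳ _) (+-identityʳ _) ⟩
  multichoose b (suc d) ∎
multichoose-vandermonde (suc a) b zero    = refl
multichoose-vandermonde (suc a) b (suc d) = begin
  1 * multichoose b (suc d) + convolveFrom (multichoose (suc a)) (multichoose b) d 1
    ≡⟨ cong (1 * multichoose b (suc d) +_) (convolveFrom-multichoose-suc a (multichoose b) d 0) ⟩
  1 * multichoose b (suc d) + (convolveFrom (multichoose a) (multichoose b) d 1
                               + convolveFrom (multichoose (suc a)) (multichoose b) d 0)
    ≡⟨ sym (+-assoc (1 * multichoose b (suc d)) _ _) ⟩
  convolveFrom (multichoose a) (multichoose b) (suc d) 0
    + convolveFrom (multichoose (suc a)) (multichoose b) d 0
    ≡⟨ cong₂ _+_ (multichoose-vandermonde a b (suc d)) (multichoose-vandermonde (suc a) b d) ⟩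
  multichoose (a + b) (suc d) + multichoose (suc a + b) d ∎

Cr-diagonal : ∀ {r} m → (∀ i → r i ≡ multichoose m i) →
              ∀ k d → Cr r (k + d) k ≡ multichoose (m * k) d
Cr-diagonal m r≗multichoose zero    zero    = refl
Cr-diagonal m r≗multichoose zero    (suc d) rewrite *-zeroʳ m = refl
Cr-diagonal {r} m r≗multichoose (suc k) d = begin
  Csum r (k + d) k 0                                          ≡⟨ Csum≡convolveFrom r (k + d) k 0 ⟩
  convolveFrom r (λ s → Cr r s k) (k + d) 0                   ≡⟨ convolveFrom-shift r (λ s → Cr r s k) k
                                                                   (λ s → Cr-above-diagonal r) d 0 ⟩
  convolveFrom r (λ e → Cr r (k + e) k) d 0                   ≡⟨ convolveFrom-cong r≗multichoose (Cr-diagonal m r≗multichoose k) d 0 ⟩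
  convolveFrom (multichoose m) (multichoose (m * k)) d 0      ≡⟨ multichoose-vandermonde m (m * k) d ⟩
  multichoose (m + m * k) d                                   ≡⟨ cong (λ x → multichoose x d) (sym (*-suc m k)) ⟩
  multichoose (m * suc k) d                                   ∎

mainTheorem10 : (n k m : ℕ) → 1 ≤ n → 1 ≤ k → 1 ≤ m → k ≤ n →
    Cr (λ i → (i + m ∸ 1) C i) n k ≡ (n ∸ k + m * k ∸ 1) C (n ∸ k)
mainTheorem10 n k m _ _ _ k≤n = begin
  Cr r n k                               ≡⟨ cong (λ x → Cr r x k) (sym (m+[n∸m]≡n k≤n)) ⟩
  Cr r (k + (n ∸ k)) k                   ≡⟨ Cr-diagonal m (C≡multichoose m) k (n ∸ k) ⟩
  multichoose (m * k) (n ∸ k)            ≡⟨ sym (C≡multichoose (m * k) (n ∸ k)) ⟩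
  (n ∸ k + m * k ∸ 1) C (n ∸ k)          ∎
  where
  r : ℕ → ℕ
  r i = (i + m ∸ 1) C i
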